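{- Let $G$ be a context-free grammar with ownership, $A$ a nondeterministic finite automaton over its terminals, $\sigma$ the least solution of the induced system of equations (in CNF), and let $\alpha$ be a sentential form with $\sigma(\alpha)$ rejecting. Let $c$ be a choice function on $\sigma(\alpha)$ that selects a rejecting box in each clause, and let $s_{\alpha,c}$ be a refuter strategy such that every maximal play from $\alpha$ conforming to it ends in a terminal word $w$ with $[w]\in\{c(K):K\in\sigma(\alpha)\}$. Then $s_{\alpha,c}$ is a winning strategy for refuter in the non-inclusion game played from $\alpha$.
   Context: Game: $G=(N_{\bigcirc}\,\dot\cup\,N_{\square},T,P)$ with disjoint finite sets of non-terminals $N=N_\bigcirc\cup N_\square$ (owned by refuter and prover, respectively) and terminals $T$, finitely many rules $X\to\eta$, every non-terminal having a rule. Left derivation: $wX\gamma\Rightarrow_L w\eta\gamma$ for $w\in T^*$ and a rule $X\to\eta$. A sentential form is owned by prover if its leftmost non-terminal is in $N_\square$, else by refuter. Plays are finite or infinite $\Rightarrow_L$-paths; maximal if infinite or ending in a terminal word. $A=(T,Q,q_0,Q_F,\to)$ has language $L(A)$. A maximal play satisfies the non-inclusion condition (refuter's goal) if it is finite and ends in a word of $T^*\setminus L(A)$. A refuter strategy maps non-maximal finite plays ending in a refuter position to a successor; it is winning from $\alpha$ if every maximal play from $\alpha$ conforming to it satisfies the non-inclusion condition. Domain: Boxes are subsets of $Q\times Q$ with $\rho;\tau=\{(q,q''):\exists q'.(q,q')\in\rho,(q',q'')\in\tau\}$, $\mathrm{id}=\{(q,q)\}$, $[w]=\{(q,q'):q\xrightarrow{w}q'\}$.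 Formulas are CNF formulas (finite sets of clauses, each a finite set of boxes; $\mathit{false}=\{\{\}\}$) with $F\wedge G=F\cup G$, $F\vee G=\{K\cup H:K\in F,H\in G\}$, $F;G=\bigcup_{K\in F}\bigcup_{z:K\to G}\{\bigcup_{\rho\in K}\{\rho;\tau:\tau\in z(\rho)\}\}$. The least solution $\sigma$ is the limit (up to logical equivalence) of $\sigma^0(X)=\mathit{false}$, $\sigma^{i+1}(X)=\bigwedge_j\sigma^i(\eta_j)$ if $X\in N_\square$ and $\bigvee_j\sigma^i(\eta_j)$ if $X\in N_\bigcirc$ (over all rules $X\to\eta_j$), with $\sigma(\varepsilon)=\{\{\mathrm{id}\}\}$, $\sigma(a)=\{\{[a]\}\}$, $\sigma(\alpha\beta)=\sigma(\alpha);\sigma(\beta)$. A box $\rho$ is rejecting if it contains no pair $(q_0,q_f)$ with $q_f\in Q_F$; a formula is rejecting if it is true under the assignment making exactly the rejecting boxes true. A choice function on a CNF formula $F$ is a map $c$ with $c(K)\in K$ for all clauses $K\in F$. -}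

module Defs where

open import Data.Nat using (ℕ; zero; suc; _≤_)
open import Data.Fin using (Fin; _≟_)
open import Data.Bool using (Bool; true; false; _∧_; _∨_; not)
open import Data.List using (List; []; _∷_; _++_; map; concat; concatMap; foldr; zipWith)
open import Data.List.Membership.Propositional using (_∈_; _∉_)
open import Data.List.Relation.Unary.Any using (here; there)
open import Data.Vec using (Vec; tabulate; lookup)
open import Data.Maybe using (Maybe; just; nothing)
open import Data.Product using (Σ; _×_; _,_; proj₁; ∃)
open import Data.Unit using (⊤)
open import Relation.Nullary using (¬_)
open import Relation.Nullary.Decidable using (⌊_⌋)
open import Relation.Binary.PropositionalEquality using (_≡_)

anyFin : ∀ {n} → (Fin n → Bool) → Bool
anyFin {zero}  f = false
anyFin {suc n} f = f Fin.zero ∨ anyFin (λ i → f (Fin.suc i))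

data Owner : Set where
  refuter prover : Owner

data Symbol (t nN : ℕ) : Set where
  term : Fin t → Symbol t nN
  nt   : Fin nN → Symbol t nN

record Grammar (t : ℕ) : Set where
  field
    nN       : ℕ
    owner    : Fin nN → Owner
    rules    : Fin nN → List (List (Symbol t nN))
    hasRule  : ∀ X → Σ (List (Symbol t nN)) (λ η → η ∈ rules X)
open Grammar public

record NFA (t : ℕ) : Set where
  field
    nQ    : ℕ
    q₀    : Fin nQ
    final : Fin nQ → Bool
    δ     : Fin nQ → Fin t → Fin nQ → Bool
open NFA public

module _ {t : ℕ} (A : NFA t) where

  reach : Fin (nQ A) → List (Fin t) → Fin (nQ A) → Bool
  reach q []      q' = ⌊ q ≟ q' ⌋
  reach q (a ∷ w) q' = anyFin (λ q'' → δ A q a q'' ∧ reach q'' w q')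

  InL : List (Fin t) → Set
  InL w = anyFin (λ qf → final A qf ∧ reach (q₀ A) w qf) ≡ true

  -- Boxes: subsets of Q × Q (as Boolean matrices)

  Box : Set
  Box = Vec (Vec Bool (nQ A)) (nQ A)

  _∋⟨_,_⟩ : Box → Fin (nQ A) → Fin (nQ A) → Bool
  ρ ∋⟨ q , q' ⟩ = lookup (lookup ρ q) q'

  _⨾_ : Box → Box → Box
  ρ ⨾ τ = tabulate λ q → tabulate λ q'' → anyFin (λ q' → (ρ ∋⟨ q , q' ⟩) ∧ (τ ∋⟨ q' , q'' ⟩))

  idBox : Box
  idBox = tabulate λ q → tabulate λ q' → ⌊ q ≟ q' ⌋

  ⟦_⟧ : List (Fin t) → Box
  ⟦ w ⟧ = tabulate λ q → tabulate λ q' → reach q w q'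

  RejectingBox : Box → Bool
  RejectingBox ρ = not (anyFin (λ qf → final A qf ∧ (ρ ∋⟨ q₀ A , qf ⟩)))

  -- CNF formulas: finite sets of clauses (lists), clauses finite sets of boxes

  Clause : Set
  Clause = List Box

  Formula : Set
  Formula = List Clause

  falseF trueF : Formula
  falseF = [] ∷ []
  trueF  = []

  _∧F_ : Formula → Formula → Formula
  F ∧F G = F ++ G

  _∨F_ : Formula → Formula → Formula
  F ∨F G = concatMap (λ K → map (λ H → K ++ H) G) F

  -- all maps z : K → G (K given as list, z as list of chosen clauses)
  choices : Clause → Formula → List (List Clause)
  choices []      G = [] ∷ []
  choices (ρ ∷ K) G = concatMap (λ C → map (C ∷_) (choices K G)) G

  composeClause : Clause → List Clause → Clause
  composeClause K zs = concat (zipWith (λ ρ C → map (ρ ⨾_) C) K zs)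

  _⨾F_ : Formula → Formula → Formula
  F ⨾F G = concatMap (λ K → map (composeClause K) (choices K G)) F

  eval : (Box → Bool) → Formula → Bool
  eval v F = foldr (λ K b → foldr (λ ρ b' → v ρ ∨ b') false K ∧ b) true F

  _≈F_ : Formula → Formula → Set
  F ≈F G = ∀ (v : Box → Bool) → eval v F ≡ eval v G

  Rejecting : Formula → Set
  Rejecting F = eval RejectingBox F ≡ true

  module _ (G : Grammar t) where

    SF : Set
    SF = List (Symbol t (nN G))

    σsym : (Fin (nN G) → Formula) → Symbol t (nN G) → Formula
    σsym ν (term a) = (⟦ a ∷ [] ⟧ ∷ []) ∷ []
    σsym ν (nt X)   = ν X

    σSF : (Fin (nN G) → Formula) → SF → Formula
    σSF ν α = foldr (λ s acc → σsym ν s ⨾F acc) ((idBox ∷ []) ∷ []) α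

    ownerOp : Owner → Formula → Formula → Formula
    ownerOp prover  = _∧F_
    ownerOp refuter = _∨F_

    ownerUnit : Owner → Formula
    ownerUnit prover  = trueF
    ownerUnit refuter = falseF

    iter : ℕ → Fin (nN G) → Formula
    iter zero    X = falseF
    iter (suc i) X = foldr (ownerOp (owner G X)) (ownerUnit (owner G X))
                           (map (σSF (iter i)) (rules G X))

    -- ν is the least solution: the limit (up to logical equivalence) of the iterates
    IsLeastSolution : (Fin (nN G) → Formula) → Set
    IsLeastSolution ν = ∃ λ k → ∀ i → k ≤ i → ∀ X → iter i X ≈F ν X

    IsChoice : Formula → (Clause → Box) → Set
    IsChoice F c = ∀ K → K ∈ F → c K ∈ K

    termWord : List (Fin t) → SF
    termWord w = map term w

    leftmost : SF → Maybe (Fin (nN G))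
    leftmost []            = nothing
    leftmost (term a ∷ α)  = leftmost α
    leftmost (nt X ∷ α)    = just X

    RefuterPos : SF → Set
    RefuterPos α = ∃ λ X → leftmost α ≡ just X × owner G X ≡ refuter

    data _⇒L_ : SF → SF → Set where
      step : (w : List (Fin t)) (X : Fin (nN G)) (η γ : SF) → η ∈ rules G X →
             (termWord w ++ nt X ∷ γ) ⇒L (termWord w ++ η ++ γ)

    data Play (α : SF) : SF → Set where
      start : Play α α
      _▷_   : ∀ {β γ} → Play α β → β ⇒L γ → Play α γ

    posOf : SF → (ℕ → SF) → ℕ → SF
    posOf α next zero    = α
    posOf α next (suc i) = next i

    record InfPlay (α : SF) : Set where
      field
        next  : ℕ → SF
        steps : ∀ i → posOf α next i ⇒L posOf α next (suc i)
    open InfPlay public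

    prefix : ∀ {α} (π : InfPlay α) (i : ℕ) → Play α (posOf α (next π) i)
    prefix π zero    = start
    prefix π (suc i) = prefix π i ▷ steps π i

    Strategy : Set
    Strategy = ∀ {α β} → Play α β → RefuterPos β → Σ SF (β ⇒L_)

    Conforms : Strategy → ∀ {α β} → Play α β → Set
    Conforms s start = ⊤
    Conforms s (_▷_ {β} {γ} p x) = Conforms s p × ((o : RefuterPos β) → proj₁ (s p o) ≡ γ)

    ConformsInf : Strategy → ∀ {α} → InfPlay α → Set
    ConformsInf s {α} π = ∀ i (o : RefuterPos (posOf α (next π) i)) →
                          proj₁ (s (prefix π i) o) ≡ posOf α (next π) (suc i)

    Winning : Strategy → SF → Set
    Winning s α =
      (∀ {β} (p : Play α β) → Conforms s p → ∀ w → β ≡ termWord w → ¬ InL w)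
      × (∀ (π : InfPlay α) → ¬ ConformsInf s π)

    EndsInChosen : Strategy → SF → (Clause → Box) → Formula → Set
    EndsInChosen s α c F =
      (∀ {β} (p : Play α β) → Conforms s p → ∀ w → β ≡ termWord w →
         ∃ λ K → K ∈ F × c K ≡ ⟦ w ⟧)
      × (∀ (π : InfPlay α) → ¬ ConformsInf s π)

module Submission where

-- Refuter's goal in the non-inclusion game has two parts:
-- every maximal conforming play is finite, and the terminal word w it
-- ends in lies outside L(A).  Finiteness is exactly the second half of
-- the hypothesis on s.  For the first half, the hypothesis gives a clause
-- K of σ(α) with [w] = c(K), and c(K) is rejecting by the choice of c.
-- So it suffices to know the automaton-level fact that a word whose box
-- [w] is rejecting is not accepted: [w] contains (q₀, q_f) iff q₀ -w→ q_f,
-- so a rejecting [w] means no accepting run on w.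

open import Defs
open import Data.Bool using (Bool; true; false; _∧_; _∨_; not)
open import Data.List using (List)
open import Data.List.Membership.Propositional using (_∈_)
open import Data.Fin using (Fin; zero; suc)
open import Data.Nat using (ℕ)
open import Data.Product using (_,_)
open import Data.Vec using (lookup; tabulate)
open import Data.Vec.Properties using (lookup∘tabulate)
open import Relation.Nullary using (¬_)
open import Relation.Binary.PropositionalEquality
  using (_≡_; refl; cong; cong₂; trans; sym; module ≡-Reasoning)

anyFin-cong : ∀ {n} {f g : Fin n → Bool} → (∀ i → f i ≡ g i) → anyFin f ≡ anyFin g
anyFin-cong {ℕ.zero}  f≗g = refl
anyFin-cong {ℕ.suc n} f≗g =
  cong₂ _∨_ (f≗g zero) (anyFin-cong (λ i → f≗g (suc i)))

module _ {t : ℕ} (A : NFA t) where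

  ⟦⟧-entry : ∀ w q q' → (A ∋⟨ ⟦_⟧ A w , q ⟩) q' ≡ reach A q w q'
  ⟦⟧-entry w q q' = begin
    lookup (lookup (⟦_⟧ A w) q) q'      ≡⟨ cong (λ r → lookup r q') (lookup∘tabulate _ q) ⟩
    lookup (tabulate (reach A q w)) q'  ≡⟨ lookup∘tabulate _ q' ⟩
    reach A q w q'                      ∎
    where open ≡-Reasoning

  RejectingBox-⟦⟧ : ∀ w →
    RejectingBox A (⟦_⟧ A w) ≡ not (anyFin (λ qf → final A qf ∧ reach A (q₀ A) w qf))
  RejectingBox-⟦⟧ w =
    cong not (anyFin-cong (λ qf → cong (final A qf ∧_) (⟦⟧-entry w (q₀ A) qf)))

  rejecting⇒∉L : ∀ w → RejectingBox A (⟦_⟧ A w) ≡ true → ¬ InL A w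
  rejecting⇒∉L w rej w∈L = false≢true (begin
    false                                                     ≡⟨ cong not (sym w∈L) ⟩
    not (anyFin (λ qf → final A qf ∧ reach A (q₀ A) w qf))    ≡⟨ sym (RejectingBox-⟦⟧ w) ⟩
    RejectingBox A (⟦_⟧ A w)                                  ≡⟨ rej ⟩
    true                                                      ∎)
    where
      open ≡-Reasoning
      false≢true : ¬ (false ≡ true)
      false≢true ()

theorem29 : ∀ {t} (G : Grammar t) (A : NFA t)
    (σ : Fin (nN G) → Formula A) → IsLeastSolution A G σ →
    (α : SF A G) → Rejecting A (σSF A G σ α) →
    (c : Clause A → Box A) → IsChoice A G (σSF A G σ α) c →
    (∀ K → K ∈ σSF A G σ α → RejectingBox A (c K) ≡ true) →
    (s : Strategy A G) → EndsInChosen A G s α c (σSF A G σ α) →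
    Winning A G s α
theorem29 G A σ _ α _ c _ c-rejecting s (ends-in-chosen , no-infinite-play) =
  ends-outside-L , no-infinite-play
  where
    -- A finite maximal play ends in w with [w] = c(K), which is rejecting.
    ends-outside-L : ∀ {β} (p : Play A G α β) → Conforms A G s p →
                     ∀ w → β ≡ termWord A G w → ¬ InL A w
    ends-outside-L p conforms w β≡w with ends-in-chosen p conforms w β≡w
    ... | K , K∈σα , cK≡⟦w⟧ =
      rejecting⇒∉L A w (trans (cong (RejectingBox A) (sym cK≡⟦w⟧)) (c-rejecting K K∈σα))
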